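{- Let $k\ge 0$, let $G$ be a finite simple connected graph and let $H$ be a convex subgraph of $G$. Then $\mathrm{f}\mu^{k}(H)\le \mathrm{f}\mu^{k}(G)$. Moreover, if $X$ is a $k$-ftmv set of $G$, then $X\cap V(H)$ is a $k$-ftmv set of $H$.
   Context: For an integer $k\ge 0$ and a connected graph $G$, a set $X\subseteq V(G)$ is a $k$-fault-tolerant mutual-visibility set ($k$-ftmv set) if for any two non-adjacent vertices $u,v\in X$ there exist $k+1$ internally vertex-disjoint shortest $u,v$-paths $Q_1,\dots,Q_{k+1}$ in $G$ such that $V(Q_i)\cap X=\{u,v\}$ for every $i$. $\mathrm{f}\mu^{k}(G)$ denotes the maximum cardinality of a $k$-ftmv set of $G$. A subgraph $H$ of $G$ is convex if for any two vertices of $H$, every shortest path in $G$ between them lies completely in $H$. -}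

module Defs where

open import Data.Nat using (ℕ; suc; _≤_)
open import Data.Fin using (Fin)
open import Data.Fin.Subset using (Subset; _∈_; ∣_∣)
open import Data.List using (List; []; _∷_; length; map)
open import Data.List.Membership.Propositional renaming (_∈_ to _∈ₗ_)
open import Data.Product using (Σ; ∃; _×_; _,_)
open import Data.Sum using (_⊎_)
open import Data.Vec using (tabulate; lookup)
open import Relation.Nullary using (¬_; Dec)
open import Relation.Binary.PropositionalEquality using (_≡_; _≢_)
open import Function.Definitions using (Injective)

record Graph : Set₁ where
  field
    n      : ℕ
    Adj    : Fin n → Fin n → Set
    adj?   : ∀ u v → Dec (Adj u v)
    sym    : ∀ {u v} → Adj u v → Adj v u
    irrefl : ∀ {u} → ¬ Adj u u

open Graph public

V : Graph → Set
V G = Fin (n G)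

-- Walk G u v xs : the vertex list xs (starting with u, ending with v)
-- is a u,v-walk in G; its length (number of edges) is length xs - 1.
data Walk (G : Graph) : V G → V G → List (V G) → Set where
  stop : ∀ u → Walk G u u (u ∷ [])
  step : ∀ {u w v xs} → Adj G u w → Walk G w v xs → Walk G u v (u ∷ xs)

-- xs is a shortest u,v-path in G (shortest walks are paths).
ShortestPath : (G : Graph) → V G → V G → List (V G) → Set
ShortestPath G u v xs =
  Walk G u v xs × (∀ ys → Walk G u v ys → length xs ≤ length ys)

Connected : Graph → Set
Connected G = ∀ u v → ∃ λ xs → Walk G u v xs

FTMV : ℕ → (G : Graph) → Subset (n G) → Set
FTMV k G X =
  ∀ u v → u ∈ X → v ∈ X → u ≢ v → ¬ Adj G u v →
  Σ (Fin (suc k) → List (V G)) λ Q →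
      (∀ i → ShortestPath G u v (Q i))
    × (∀ i j → i ≢ j → ∀ x → x ∈ₗ Q i → x ∈ₗ Q j → x ≡ u ⊎ x ≡ v)
    × (∀ i x → x ∈ₗ Q i → x ∈ X → x ≡ u ⊎ x ≡ v)

IsFμ : ℕ → (G : Graph) → ℕ → Set
IsFμ k G m =
  (Σ (Subset (n G)) λ X → FTMV k G X × ∣ X ∣ ≡ m)
  × (∀ X → FTMV k G X → ∣ X ∣ ≤ m)

record Subgraph (H G : Graph) : Set where
  field
    ι     : V H → V G
    ι-inj : Injective _≡_ _≡_ ι
    ι-adj : ∀ {i j} → Adj H i j → Adj G (ι i) (ι j)

open Subgraph public

Convex : (H G : Graph) → Subgraph H G → Set
Convex H G S =
  ∀ i j xs → ShortestPath G (ι S i) (ι S j) xs →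
  Σ (List (V H)) λ ys → Walk H i j ys × map (ι S) ys ≡ xs

restrict : (H G : Graph) → Subgraph H G → Subset (n G) → Subset (n H)
restrict H G S X = tabulate (λ i → lookup X (ι S i))

{-# OPTIONS --safe #-}
module Submission where

-- Convexity makes H an isometric, induced subgraph of G: a G-walk shorter than
-- the image of a shortest H-path would yield a shortest G-path no longer than it,
-- which convexity pulls back into H; and every shortest G-path between vertices of H
-- is the image of a shortest H-path. So the k+1 witnessing paths of a pair of
-- vertices transport along the embedding in both directions; in particular the
-- injective image of a k-ftmv set of H is k-ftmv in G, which bounds fμ^k(H) by fμ^k(G).

open import Defs hiding (sym)
open import Data.Nat using (ℕ; zero; suc; _≤_; _<_; z≤n; s≤s; z<s)
open import Data.Nat.Properties
  using (≤-trans; ≤-refl; <⇒≤; <⇒≢; ≤-<-trans; ≮⇒≥; suc-injective; anyUpTo?; module ≤-Reasoning)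
open import Data.Nat.Induction using (<-rec)
open import Data.Bool using (Bool; true)
open import Data.Fin using (Fin; zero; suc; _≟_)
open import Data.Fin.Properties using (any?; 0≢1+n) renaming (suc-injective to Fin-suc-injective)
open import Data.Fin.Subset using (Subset; _∈_; ∣_∣; _-_; inside; outside)
open import Data.Fin.Subset.Properties using (_∈?_; x∈p∧x≢y⇒x∈p-y; x∈p⇒∣p-x∣<∣p∣)
open import Data.Vec using ([]; _∷_; here; there; tabulate; lookup)
open import Data.Vec.Properties using (lookup∘tabulate; []=⇒lookup; lookup⇒[]=)
open import Data.List using (List; []; _∷_; length; map)
open import Data.List.Properties using (length-map)
open import Data.List.Membership.Propositional renaming (_∈_ to _∈ₗ_)
open import Data.List.Membership.Propositional.Properties using (∈-map⁺; ∈-map⁻)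
open import Data.Product using (Σ; ∃; _×_; _,_; proj₁; proj₂)
open import Data.Sum using (_⊎_) renaming (map to ⊎-map)
open import Relation.Nullary using (Dec; yes; no; does; contradiction)
open import Relation.Nullary.Decidable using (_×-dec_; dec-true)
open import Relation.Binary.PropositionalEquality using (_≡_; _≢_; refl; sym; trans; cong; subst)
open import Function using (_∘_)
open import Function.Definitions using (Injective)

MeetsOnlyAt : {A : Set} → A → A → (A → Set) → List A → Set
MeetsOnlyAt u v P xs = ∀ x → x ∈ₗ xs → P x → x ≡ u ⊎ x ≡ v

module _ {A B : Set} {f : A → B} where

  ∈-map⁻-injective : Injective _≡_ _≡_ f → ∀ {x xs} → f x ∈ₗ map f xs → x ∈ₗ xs
  ∈-map⁻-injective inj {xs = xs} fx∈ with ∈-map⁻ f fx∈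
  ... | y , y∈ , fx≡fy = subst (_∈ₗ xs) (sym (inj fx≡fy)) y∈

  MeetsOnlyAt-map : ∀ {u v} {P : A → Set} {P′ : B → Set} {xs} →
                    (∀ {x} → P′ (f x) → P x) →
                    MeetsOnlyAt u v P xs → MeetsOnlyAt (f u) (f v) P′ (map f xs)
  MeetsOnlyAt-map P′⇒P meets y y∈ P′y with ∈-map⁻ f y∈
  ... | x , x∈ , refl = ⊎-map (cong f) (cong f) (meets x x∈ (P′⇒P P′y))

  MeetsOnlyAt-pullback : Injective _≡_ _≡_ f → ∀ {u v} {P : A → Set} {P′ : B → Set} {xs ys} →
                         (∀ {x} → x ∈ₗ xs → f x ∈ₗ ys) → (∀ {x} → P x → P′ (f x)) →
                         MeetsOnlyAt (f u) (f v) P′ ys → MeetsOnlyAt u v P xs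
  MeetsOnlyAt-pullback inj xs⇒ys P⇒P′ meets x x∈ Px =
    ⊎-map inj inj (meets (f x) (xs⇒ys x∈) (P⇒P′ Px))

∈-tabulate⁺ : ∀ {m} (g : Fin m → Bool) {x} → g x ≡ true → x ∈ tabulate g
∈-tabulate⁺ g {x} gx = lookup⇒[]= x (tabulate g) (trans (lookup∘tabulate g x) gx)

∈-tabulate⁻ : ∀ {m} (g : Fin m → Bool) {x} → x ∈ tabulate g → g x ≡ true
∈-tabulate⁻ g {x} x∈ = trans (sym (lookup∘tabulate g x)) ([]=⇒lookup x∈)

∈-restrict⁻ : ∀ {H G} (S : Subgraph H G) {X x} → x ∈ restrict H G S X → ι S x ∈ X
∈-restrict⁻ S {X} {x} x∈ = lookup⇒[]= (ι S x) X (∈-tabulate⁻ (λ i → lookup X (ι S i)) x∈)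

module _ {m m′ : ℕ} (f : Fin m → Fin m′) where

  image : Subset m → Subset m′
  image p = tabulate λ y → does (any? λ x → x ∈? p ×-dec f x ≟ y)

  ∈-image⁺ : ∀ {p x} → x ∈ p → f x ∈ image p
  ∈-image⁺ {p} {x} x∈ =
    ∈-tabulate⁺ _ (dec-true (any? λ x′ → x′ ∈? p ×-dec f x′ ≟ f x) (x , x∈ , refl))

  ∈-image⁻ : ∀ {p y} → y ∈ image p → ∃ λ x → x ∈ p × f x ≡ y
  ∈-image⁻ {p} {y} y∈ with any? (λ x → x ∈? p ×-dec f x ≟ y) | ∈-tabulate⁻ _ y∈
  ... | yes witness | _ = witness
  ... | no _        | ()

  ∈-image⁻-injective : Injective _≡_ _≡_ f → ∀ {p x} → f x ∈ image p → x ∈ p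
  ∈-image⁻-injective inj fx∈ with ∈-image⁻ fx∈
  ... | x′ , x′∈ , fx′≡fx = subst (_∈ _) (inj fx′≡fx) x′∈

injective⇒∣p∣≤∣q∣ : ∀ {m m′} {f : Fin m → Fin m′} → Injective _≡_ _≡_ f →
                    ∀ p {q} → (∀ {x} → x ∈ p → f x ∈ q) → ∣ p ∣ ≤ ∣ q ∣
injective⇒∣p∣≤∣q∣ inj []            p⇒q = z≤n
injective⇒∣p∣≤∣q∣ inj (outside ∷ p) p⇒q =
  injective⇒∣p∣≤∣q∣ (Fin-suc-injective ∘ inj) p (p⇒q ∘ there)
injective⇒∣p∣≤∣q∣ {f = f} inj (inside ∷ p) {q} p⇒q =
  ≤-trans (s≤s (injective⇒∣p∣≤∣q∣ (Fin-suc-injective ∘ inj) p p⇒q-f0))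
          (x∈p⇒∣p-x∣<∣p∣ (p⇒q here))
  where
  p⇒q-f0 : ∀ {x} → x ∈ p → f (suc x) ∈ q - f zero
  p⇒q-f0 x∈ = x∈p∧x≢y⇒x∈p-y (p⇒q (there x∈)) (0≢1+n ∘ sym ∘ inj)

Walk-map : ∀ {H G} (S : Subgraph H G) {u v xs} → Walk H u v xs → Walk G (ι S u) (ι S v) (map (ι S) xs)
Walk-map S (stop u)   = stop (ι S u)
Walk-map S (step a w) = step (ι-adj S a) (Walk-map S w)

module _ {G : Graph} where

  0<length-walk : ∀ {u v xs} → Walk G u v xs → 0 < length xs
  0<length-walk (stop _)   = z<s
  0<length-walk (step _ _) = z<s

  2≤length-walk : ∀ {u v xs} → u ≢ v → Walk G u v xs → 2 ≤ length xs
  2≤length-walk u≢v (stop _)   = contradiction refl u≢v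
  2≤length-walk u≢v (step _ w) = s≤s (0<length-walk w)

  edge-shortestPath : ∀ {u v} → u ≢ v → Adj G u v → ShortestPath G u v (u ∷ v ∷ [])
  edge-shortestPath u≢v a = step a (stop _) , λ _ → 2≤length-walk u≢v

  Adj-of-walk↦pair : ∀ {A : Set} {f : V G → A} {u v xs y z} →
                     Walk G u v xs → map f xs ≡ y ∷ z ∷ [] → Adj G u v
  Adj-of-walk↦pair (stop _)                   ()
  Adj-of-walk↦pair (step a (stop _))          _ = a
  Adj-of-walk↦pair (step _ (step _ (stop _))) ()
  Adj-of-walk↦pair (step _ (step _ (step _ _))) ()

  WalkOfLength : V G → V G → ℕ → Set
  WalkOfLength u v m = ∃ λ xs → Walk G u v xs × length xs ≡ m

  walkOfLength? : ∀ u v m → Dec (WalkOfLength u v m)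
  walkOfLength? u v zero = no λ (_ , w , eq) → <⇒≢ (0<length-walk w) (sym eq)
  walkOfLength? u v (suc zero) with u ≟ v
  ... | yes refl = yes (_ , stop u , refl)
  ... | no u≢v   = no λ where
    (_ , stop _ , _)    → u≢v refl
    (_ , step _ w , eq) → <⇒≢ (0<length-walk w) (sym (suc-injective eq))
  walkOfLength? u v (suc (suc m)) with any? (λ w → adj? G u w ×-dec walkOfLength? w v (suc m))
  ... | yes (w , a , xs , walk , eq) = yes (u ∷ xs , step a walk , cong suc eq)
  ... | no none = no λ where
    (_ , step {w = w} a walk , eq) → none (w , a , _ , walk , suc-injective eq)

  shortestPath-within : ∀ {u v} m → WalkOfLength u v m →
                        ∃ λ xs → ShortestPath G u v xs × length xs ≤ m
  shortestPath-within {u} {v} = <-rec _ minimise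
    where
    minimise : ∀ m → (∀ {m′} → m′ < m → WalkOfLength u v m′ →
                        ∃ λ xs → ShortestPath G u v xs × length xs ≤ m′) →
               WalkOfLength u v m → ∃ λ xs → ShortestPath G u v xs × length xs ≤ m
    minimise m shorter (xs , walk , refl) with anyUpTo? (walkOfLength? u v) m
    ... | yes (m′ , m′<m , walk′) =
      let (ys , sp , ys≤m′) = shorter m′<m walk′ in ys , sp , <⇒≤ (≤-<-trans ys≤m′ m′<m)
    ... | no none =
      xs , (walk , λ ys walk′ → ≮⇒≥ λ ys<xs → none (length ys , ys<xs , ys , walk′ , refl)) , ≤-refl

  shortestPath-exists : ∀ {u v ws} → Walk G u v ws →
                        ∃ λ xs → ShortestPath G u v xs × length xs ≤ length ws
  shortestPath-exists walk = shortestPath-within _ (_ , walk , refl)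

-- FTMV k G X unfolds definitionally to: for all admissible u, v, FTPaths k G X u v.
FTPaths : ℕ → (G : Graph) → Subset (n G) → V G → V G → Set
FTPaths k G X u v =
  Σ (Fin (suc k) → List (V G)) λ Q →
      (∀ i → ShortestPath G u v (Q i))
    × (∀ i j → i ≢ j → MeetsOnlyAt u v (_∈ₗ Q j) (Q i))
    × (∀ i → MeetsOnlyAt u v (_∈ X) (Q i))

module _ {H G : Graph} (S : Subgraph H G) (convex : Convex H G S) where

  shortestPath-map : ∀ {u v xs} → ShortestPath H u v xs → ShortestPath G (ι S u) (ι S v) (map (ι S) xs)
  shortestPath-map {u} {v} {xs} (walk , minimal) = Walk-map S walk , λ ys walk′ →
    let (P , spP , P≤ys) = shortestPath-exists walk′
        (zs , walk-zs , zs↦P) = convex u v P spP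
        open ≤-Reasoning
    in begin
      length (map (ι S) xs)  ≡⟨ length-map (ι S) xs ⟩
      length xs              ≤⟨ minimal zs walk-zs ⟩
      length zs              ≡⟨ sym (length-map (ι S) zs) ⟩
      length (map (ι S) zs)  ≡⟨ cong length zs↦P ⟩
      length P               ≤⟨ P≤ys ⟩
      length ys              ∎

  shortestPath-pullback : ∀ {u v P} → ShortestPath G (ι S u) (ι S v) P →
                          ∃ λ zs → ShortestPath H u v zs × map (ι S) zs ≡ P
  shortestPath-pullback {u} {v} sp@(_ , minimal) with convex u v _ sp
  ... | zs , walk , refl = zs , (walk , λ ys walk′ → begin
      length zs              ≡⟨ sym (length-map (ι S) zs) ⟩
      length (map (ι S) zs)  ≤⟨ minimal _ (Walk-map S walk′) ⟩
      length (map (ι S) ys)  ≡⟨ length-map (ι S) ys ⟩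
      length ys              ∎) , refl
    where open ≤-Reasoning

  Adj-reflect : ∀ {u v} → u ≢ v → Adj G (ι S u) (ι S v) → Adj H u v
  Adj-reflect u≢v a with shortestPath-pullback (edge-shortestPath (u≢v ∘ ι-inj S) a)
  ... | _ , (walk , _) , zs↦uv = Adj-of-walk↦pair walk zs↦uv

  FTPaths-pullback : ∀ {k X Y u v} → (∀ {x} → x ∈ X → ι S x ∈ Y) →
                     FTPaths k G Y (ι S u) (ι S v) → FTPaths k H X u v
  FTPaths-pullback {k} {X} {u = u} {v} X⇒Y (Q , sp , disjoint , avoidsY) =
    R , (proj₁ ∘ proj₂ ∘ pull) , disjointR , avoidsX
    where
    pull : ∀ i → ∃ λ zs → ShortestPath H u v zs × map (ι S) zs ≡ Q i
    pull i = shortestPath-pullback (sp i)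
    R : Fin (suc k) → List (V H)
    R = proj₁ ∘ pull
    R⇒Q : ∀ i {x} → x ∈ₗ R i → ι S x ∈ₗ Q i
    R⇒Q i x∈ = subst (_ ∈ₗ_) (proj₂ (proj₂ (pull i))) (∈-map⁺ (ι S) x∈)
    disjointR : ∀ i j → i ≢ j → MeetsOnlyAt u v (_∈ₗ R j) (R i)
    disjointR i j i≢j = MeetsOnlyAt-pullback (ι-inj S) (R⇒Q i) (R⇒Q j) (disjoint i j i≢j)
    avoidsX : ∀ i → MeetsOnlyAt u v (_∈ X) (R i)
    avoidsX i = MeetsOnlyAt-pullback (ι-inj S) (R⇒Q i) X⇒Y (avoidsY i)

  FTPaths-map : ∀ {k X Y u v} → (∀ {x} → ι S x ∈ Y → x ∈ X) →
                FTPaths k H X u v → FTPaths k G Y (ι S u) (ι S v)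
  FTPaths-map Y⇒X (R , sp , disjoint , avoidsX) =
      map (ι S) ∘ R
    , shortestPath-map ∘ sp
    , (λ i j i≢j → MeetsOnlyAt-map (∈-map⁻-injective (ι-inj S)) (disjoint i j i≢j))
    , (λ i → MeetsOnlyAt-map Y⇒X (avoidsX i))

  FTMV-restrict : ∀ {k X} → FTMV k G X → FTMV k H (restrict H G S X)
  FTMV-restrict ftmv u v u∈ v∈ u≢v u≁v =
    FTPaths-pullback (∈-restrict⁻ S)
      (ftmv _ _ (∈-restrict⁻ S u∈) (∈-restrict⁻ S v∈) (u≢v ∘ ι-inj S) (u≁v ∘ Adj-reflect u≢v))

  FTMV-image : ∀ {k X} → FTMV k H X → FTMV k G (image (ι S) X)
  FTMV-image ftmv y z y∈ z∈ y≢z y≁z with ∈-image⁻ (ι S) y∈ | ∈-image⁻ (ι S) z∈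
  ... | u , u∈ , refl | v , v∈ , refl =
    FTPaths-map (∈-image⁻-injective (ι S) (ι-inj S))
      (ftmv u v u∈ v∈ (y≢z ∘ cong (ι S)) (y≁z ∘ ι-adj S))

lemma3p4 : (k : ℕ) (G H : Graph) → Connected G → (S : Subgraph H G) → Convex H G S →
    (∀ a b → IsFμ k H a → IsFμ k G b → a ≤ b)
    × (∀ (X : Subset (n G)) → FTMV k G X → FTMV k H (restrict H G S X))
lemma3p4 k G H _ S convex = fμ-mono , λ _ → FTMV-restrict S convex
  where
  fμ-mono : ∀ a b → IsFμ k H a → IsFμ k G b → a ≤ b
  fμ-mono a b ((X , ftmv , refl) , _) (_ , maximum) =
    ≤-trans (injective⇒∣p∣≤∣q∣ (ι-inj S) X (∈-image⁺ (ι S)))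
            (maximum _ (FTMV-image S convex ftmv))
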